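{- Fix a positive integer $k$. If $t$ and $s$ are two binary tree patterns each having $k$ leaves, then $g_t(x)=g_s(x)$.
   Context: All trees are full binary trees: rooted, ordered (plane) trees in which every vertex has either $0$ children (a leaf) or exactly $2$ ordered children (left and right). A binary tree pattern is such a tree. A tree $T$ contains a pattern $t$ (non-contiguously) if there is a tree $T^*$ obtained from $T$ by a finite sequence of edge contractions such that $t$ is a contiguous, rooted, ordered subtree of $T^*$; concretely, there is an injective map $\varphi$ from the vertices of $t$ to those of $T$ such that for every internal vertex $u$ of $t$ with left child $u_1$ and right child $u_2$, $\varphi(u_1)$ lies in the subtree rooted at the left child of $\varphi(u)$ and $\varphi(u_2)$ lies in the subtree rooted at the right child of $\varphi(u)$. Otherwise $T$ avoids $t$. Let $\mathrm{av}_t(n)$ be the number of binary trees with $n$ leaves avoiding $t$, with $\mathrm{av}_t(0)=0$, and $g_t(x)=\sum_{n\ge 0}\mathrm{av}_t(n)x^n$. -}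

module Defs where

open import Data.Nat using (ℕ; zero; suc; _+_; _≟_)
open import Data.List using (List; []; _∷_; length; filter; concatMap)
import Data.List as List
open import Data.Product using (_×_; _,_)
open import Relation.Nullary using (¬_; Dec; yes; no)
open import Relation.Nullary.Decidable using (_×-dec_; _⊎-dec_; ¬?; map′)
open import Data.Sum using (_⊎_; inj₁; inj₂)

data Tree : Set where
  leaf : Tree
  node : Tree → Tree → Tree

leaves : Tree → ℕ
leaves leaf       = 1
leaves (node l r) = leaves l + leaves r

-- Non-contiguous containment: Contains T t  iff there is a map φ from the
-- vertices of t to those of T as in the paper.  Unfolded recursively:
-- φ(root t) is some vertex v of T; if t is a leaf nothing more is required,
-- if t = node t₁ t₂ then v = node L R with t₁ contained in L and t₂ in R.
data Contains : Tree → Tree → Set where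
  here-leaf : ∀ {T} → Contains T leaf
  here-node : ∀ {L R t₁ t₂} → Contains L t₁ → Contains R t₂ →
              Contains (node L R) (node t₁ t₂)
  go-left   : ∀ {L R t} → Contains L t → Contains (node L R) t
  go-right  : ∀ {L R t} → Contains R t → Contains (node L R) t

Avoids : Tree → Tree → Set
Avoids T t = ¬ Contains T t

contains? : (T t : Tree) → Dec (Contains T t)
contains? T leaf = yes here-leaf
contains? leaf (node a b) = no (λ ())
contains? (node L R) (node a b) =
  map′ from to ((contains? L a ×-dec contains? R b) ⊎-dec
                (contains? L (node a b) ⊎-dec contains? R (node a b)))
  where
  from : (Contains L a × Contains R b) ⊎ (Contains L (node a b) ⊎ Contains R (node a b)) →
         Contains (node L R) (node a b)
  from (inj₁ (p , q))   = here-node p q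
  from (inj₂ (inj₁ l)) = go-left l
  from (inj₂ (inj₂ r)) = go-right r
  to : Contains (node L R) (node a b) →
       (Contains L a × Contains R b) ⊎ (Contains L (node a b) ⊎ Contains R (node a b))
  to (here-node p q) = inj₁ (p , q)
  to (go-left l)     = inj₂ (inj₁ l)
  to (go-right r)    = inj₂ (inj₂ r)

-- All trees of height at most d (each exactly once).  A tree with n leaves
-- has height at most n, so treesOfHeight≤ n contains every tree with n leaves.
treesOfHeight≤ : ℕ → List Tree
treesOfHeight≤ zero    = leaf ∷ []
treesOfHeight≤ (suc d) =
  leaf ∷ concatMap (λ l → List.map (node l) (treesOfHeight≤ d)) (treesOfHeight≤ d)

-- av_t(n): number of binary trees with n leaves avoiding t (av_t(0) = 0
-- automatically, as no tree has 0 leaves).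
av : Tree → ℕ → ℕ
av t n = length (filter (λ T → (leaves T ≟ n) ×-dec ¬? (contains? T t))
                        (treesOfHeight≤ n))

module Submission where

-- Let g_t = ∑_T [T avoids t] x^{leaves T} ∈ ℤ[[x]].  Splitting the
-- t-avoiders, t = node t₁ t₂, by whether they contain t₁, and a tree
-- node l r by the behaviour of l and r, gives two linear relations whose
-- combination is the quadratic relation
--     g_t (1 - g_{t₁} - g_{t₂}) = x - g_{t₁} g_{t₂}.
-- Since 1 - g_{t₁} - g_{t₂} has constant term 1 it is cancellable, so the
-- relation determines g_t from g_{t₁}, g_{t₂}.  For the right combs c_k one
-- gets c_{m+1} (1 - c_m) = x, and pure ring algebra shows that c_{x+y+1}
-- solves the relation with (c_x, c_y).  By induction on t, g_t = c_k.

open import Defs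
open import Data.Bool using (Bool; true; false; _∧_; _∨_; not) renaming (T to Holds)
open import Data.Unit using (tt)
open import Data.Empty using (⊥-elim)
open import Data.Nat as ℕ using (ℕ; zero; suc; _≡ᵇ_; _≤_; _<_; _≤′_; z≤n; s≤s)
import Data.Nat.Properties as ℕ
open import Data.Integer as ℤ using (ℤ; 0ℤ; 1ℤ; _+_; _*_; -_)
import Data.Integer.Properties as ℤ
open import Data.Integer.Tactic.RingSolver using (solve-∀)
open import Data.List using (List; []; _∷_; _++_; map; concatMap; filter; length)
open import Data.Product using (_,_)
open import Data.Maybe using (Maybe; just; nothing)
open import Relation.Nullary using (Dec; does; yes; no)
open import Relation.Binary.PropositionalEquality
  using (_≡_; _≗_; refl; sym; trans; cong; cong₂; subst; module ≡-Reasoning)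
import Relation.Binary.Reasoning.Setoid
open import Algebra.Bundles using (CommutativeRing)
open import Algebra.Properties.CommutativeSemigroup ℤ.+-commutativeSemigroup using (x∙yz≈y∙xz)
open import Algebra.Solver.Ring.AlmostCommutativeRing
  using (fromCommutativeRing; _-Raw-AlmostCommutative⟶_)

Series : Set
Series = ℕ → ℤ

infix  4 _≈_
infixl 6 _⊕_ _⊝_
infixl 7 _⊗_ _•_

-- Equality of series: all coefficients agree.  It is wrapped in a record so
-- that it is not unfolded while inferring the arguments of congruences.
record _≈_ (f g : Series) : Set where
  constructor coefficientwise
  field coefficient : f ≗ g
open _≈_ public

_⊕_ : Series → Series → Series
(f ⊕ g) n = f n + g n

⊖_ : Series → Series
(⊖ f) n = - f n

_⊝_ : Series → Series → Series
f ⊝ g = f ⊕ ⊖ g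

_•_ : ℤ → Series → Series
(c • f) n = c * f n

constant : ℤ → Series
constant c zero    = c
constant c (suc _) = 0ℤ

𝟘 𝟙 : Series
𝟘 _ = 0ℤ
𝟙   = constant 1ℤ

shift : Series → Series
shift f n = f (suc n)

-- Cauchy product, unfolded along the left factor:
-- f · g = f₀ g + x · (shift f · g).
_⊗_ : Series → Series → Series
(f ⊗ g) zero    = f 0 * g 0
(f ⊗ g) (suc n) = f 0 * g (suc n) + (shift f ⊗ g) n

⊗-cong≗ : ∀ {f f′ g g′} → f ≗ f′ → g ≗ g′ → f ⊗ g ≗ f′ ⊗ g′
⊗-cong≗ p q zero    = cong₂ _*_ (p 0) (q 0)
⊗-cong≗ p q (suc n) = cong₂ _+_ (cong₂ _*_ (p 0) (q (suc n))) (⊗-cong≗ (λ k → p (suc k)) q n)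

-- The same product unfolded along the right factor; the key to commutativity.
⊗-unfoldʳ : ∀ f g n → (f ⊗ g) (suc n) ≡ g 0 * f (suc n) + (f ⊗ shift g) n
⊗-unfoldʳ f g zero    = swap (f 0) (g 1) (f 1) (g 0)
  where
  swap : ∀ a b c d → a * b + c * d ≡ d * c + a * b
  swap = solve-∀
⊗-unfoldʳ f g (suc n) = begin
    f 0 * g (suc (suc n)) + (shift f ⊗ g) (suc n)
  ≡⟨ cong (f 0 * g (suc (suc n)) +_) (⊗-unfoldʳ (shift f) g n) ⟩
    f 0 * g (suc (suc n)) + (g 0 * f (suc (suc n)) + (shift f ⊗ shift g) n)
  ≡⟨ x∙yz≈y∙xz (f 0 * g (suc (suc n))) (g 0 * f (suc (suc n))) ((shift f ⊗ shift g) n) ⟩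
    g 0 * f (suc (suc n)) + (f 0 * g (suc (suc n)) + (shift f ⊗ shift g) n) ∎
  where open ≡-Reasoning

⊗-comm : ∀ f g → f ⊗ g ≗ g ⊗ f
⊗-comm f g zero    = ℤ.*-comm (f 0) (g 0)
⊗-comm f g (suc n) = begin
    f 0 * g (suc n) + (shift f ⊗ g) n
  ≡⟨ cong (f 0 * g (suc n) +_) (⊗-comm (shift f) g n) ⟩
    f 0 * g (suc n) + (g ⊗ shift f) n
  ≡⟨ ⊗-unfoldʳ g f n ⟨
    (g ⊗ f) (suc n) ∎
  where open ≡-Reasoning

⊗-zeroˡ : ∀ f → 𝟘 ⊗ f ≗ 𝟘
⊗-zeroˡ f zero    = refl
⊗-zeroˡ f (suc n) = cong (0ℤ +_) (⊗-zeroˡ f n)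

⊗-identityˡ : ∀ f → 𝟙 ⊗ f ≗ f
⊗-identityˡ f zero    = ℤ.*-identityˡ (f 0)
⊗-identityˡ f (suc n) = begin
    1ℤ * f (suc n) + (𝟘 ⊗ f) n  ≡⟨ cong₂ _+_ (ℤ.*-identityˡ (f (suc n))) (⊗-zeroˡ f n) ⟩
    f (suc n) + 0ℤ              ≡⟨ ℤ.+-identityʳ (f (suc n)) ⟩
    f (suc n)                   ∎
  where open ≡-Reasoning

⊗-distribʳ : ∀ h f g → (f ⊕ g) ⊗ h ≗ f ⊗ h ⊕ g ⊗ h
⊗-distribʳ h f g zero    = ℤ.*-distribʳ-+ (h 0) (f 0) (g 0)
⊗-distribʳ h f g (suc n) = begin
    (f 0 + g 0) * h (suc n) + ((shift f ⊕ shift g) ⊗ h) n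
  ≡⟨ cong ((f 0 + g 0) * h (suc n) +_) (⊗-distribʳ h (shift f) (shift g) n) ⟩
    (f 0 + g 0) * h (suc n) + ((shift f ⊗ h) n + (shift g ⊗ h) n)
  ≡⟨ rearrange (f 0) (g 0) (h (suc n)) _ _ ⟩
    (f 0 * h (suc n) + (shift f ⊗ h) n) + (g 0 * h (suc n) + (shift g ⊗ h) n) ∎
  where
  open ≡-Reasoning
  rearrange : ∀ a b c x y → (a + b) * c + (x + y) ≡ (a * c + x) + (b * c + y)
  rearrange = solve-∀

⊗-distribˡ : ∀ h f g → h ⊗ (f ⊕ g) ≗ h ⊗ f ⊕ h ⊗ g
⊗-distribˡ h f g n = begin
  (h ⊗ (f ⊕ g)) n        ≡⟨ ⊗-comm h (f ⊕ g) n ⟩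
  ((f ⊕ g) ⊗ h) n        ≡⟨ ⊗-distribʳ h f g n ⟩
  (f ⊗ h) n + (g ⊗ h) n  ≡⟨ cong₂ _+_ (⊗-comm f h n) (⊗-comm g h n) ⟩
  (h ⊗ f) n + (h ⊗ g) n  ∎
  where open ≡-Reasoning

⊗-scaleˡ : ∀ c f g → (c • f) ⊗ g ≗ c • (f ⊗ g)
⊗-scaleˡ c f g zero    = ℤ.*-assoc c (f 0) (g 0)
⊗-scaleˡ c f g (suc n) = begin
    (c * f 0) * g (suc n) + ((c • shift f) ⊗ g) n
  ≡⟨ cong ((c * f 0) * g (suc n) +_) (⊗-scaleˡ c (shift f) g n) ⟩
    (c * f 0) * g (suc n) + c * (shift f ⊗ g) n
  ≡⟨ rearrange c (f 0) (g (suc n)) _ ⟩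
    c * (f 0 * g (suc n) + (shift f ⊗ g) n) ∎
  where
  open ≡-Reasoning
  rearrange : ∀ c a b d → (c * a) * b + c * d ≡ c * (a * b + d)
  rearrange = solve-∀

-- Associativity, using that the tail of f ⊗ g is f₀ • shift g ⊕ shift f ⊗ g.
⊗-assoc : ∀ f g h → (f ⊗ g) ⊗ h ≗ f ⊗ (g ⊗ h)
⊗-assoc f g h zero    = ℤ.*-assoc (f 0) (g 0) (h 0)
⊗-assoc f g h (suc n) = begin
    (f 0 * g 0) * h (suc n) + ((f 0 • shift g ⊕ shift f ⊗ g) ⊗ h) n
  ≡⟨ cong ((f 0 * g 0) * h (suc n) +_) tail ⟩
    (f 0 * g 0) * h (suc n) + (f 0 * (shift g ⊗ h) n + (shift f ⊗ (g ⊗ h)) n)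
  ≡⟨ rearrange (f 0) (g 0) (h (suc n)) _ _ ⟩
    f 0 * (g 0 * h (suc n) + (shift g ⊗ h) n) + (shift f ⊗ (g ⊗ h)) n ∎
  where
  open ≡-Reasoning
  rearrange : ∀ a b c x y → (a * b) * c + (a * x + y) ≡ a * (b * c + x) + y
  rearrange = solve-∀
  tail : ((f 0 • shift g ⊕ shift f ⊗ g) ⊗ h) n ≡ f 0 * (shift g ⊗ h) n + (shift f ⊗ (g ⊗ h)) n
  tail = trans (⊗-distribʳ h (f 0 • shift g) (shift f ⊗ g) n)
               (cong₂ _+_ (⊗-scaleˡ (f 0) (shift g) h n) (⊗-assoc (shift f) g h n))

seriesRing : CommutativeRing _ _
seriesRing = record
  { Carrier = Series ; _≈_ = _≈_ ; _+_ = _⊕_ ; _*_ = _⊗_ ; -_ = ⊖_ ; 0# = 𝟘 ; 1# = 𝟙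
  ; isCommutativeRing = record
    { isRing = record
      { +-isAbelianGroup = record
        { isGroup = record
          { isMonoid = record
            { isSemigroup = record
              { isMagma = record
                { isEquivalence = record
                  { refl  = coefficientwise (λ _ → refl)
                  ; sym   = λ p → coefficientwise (λ n → sym (coefficient p n))
                  ; trans = λ p q → coefficientwise (λ n → trans (coefficient p n) (coefficient q n)) }
                ; ∙-cong = λ p q → coefficientwise (λ n → cong₂ _+_ (coefficient p n) (coefficient q n)) }
              ; assoc = λ f g h → coefficientwise (λ n → ℤ.+-assoc (f n) (g n) (h n)) }
            ; identity = (λ f → coefficientwise (λ n → ℤ.+-identityˡ (f n)))
                       , (λ f → coefficientwise (λ n → ℤ.+-identityʳ (f n))) }
          ; inverse = (λ f → coefficientwise (λ n → ℤ.+-inverseˡ (f n)))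
                    , (λ f → coefficientwise (λ n → ℤ.+-inverseʳ (f n)))
          ; ⁻¹-cong = λ p → coefficientwise (λ n → cong -_ (coefficient p n)) }
        ; comm = λ f g → coefficientwise (λ n → ℤ.+-comm (f n) (g n)) }
      ; *-cong = λ p q → coefficientwise (⊗-cong≗ (coefficient p) (coefficient q))
      ; *-assoc = λ f g h → coefficientwise (⊗-assoc f g h)
      ; *-identity = (λ f → coefficientwise (⊗-identityˡ f))
                   , (λ f → coefficientwise (λ n → trans (⊗-comm f 𝟙 n) (⊗-identityˡ f n)))
      ; distrib = (λ h f g → coefficientwise (⊗-distribˡ h f g))
                , (λ h f g → coefficientwise (⊗-distribʳ h f g)) }
    ; *-comm = λ f g → coefficientwise (⊗-comm f g) } }

-- To run the ring solver on series, integers are embedded as constant series;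
-- this embedding is a ring morphism.
constant-0 : constant 0ℤ ≈ 𝟘
constant-0 = coefficientwise (λ { zero → refl ; (suc n) → refl })

constant-* : ∀ a b → constant (a * b) ≗ constant a ⊗ constant b
constant-* a b zero    = refl
constant-* a b (suc n) = sym (cong₂ _+_ (ℤ.*-zeroʳ a) (⊗-zeroˡ (constant b) n))

constant-morphism : ℤ.+-*-rawRing -Raw-AlmostCommutative⟶ fromCommutativeRing seriesRing
constant-morphism = record
  { ⟦_⟧    = constant
  ; +-homo = λ a b → coefficientwise (λ { zero → refl ; (suc n) → refl })
  ; *-homo = λ a b → coefficientwise (constant-* a b)
  ; -‿homo = λ a → coefficientwise (λ { zero → refl ; (suc n) → refl })
  ; 0-homo = constant-0
  ; 1-homo = coefficientwise (λ _ → refl) }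

constants-equal? : ∀ a b → Maybe (constant a ≈ constant b)
constants-equal? a b with a ℤ.≟ b
... | yes refl = just (coefficientwise (λ _ → refl))
... | no _     = nothing

open import Algebra.Solver.Ring ℤ.+-*-rawRing (fromCommutativeRing seriesRing) constant-morphism constants-equal?
  using (solve; _:=_; _:+_; _:*_; _:-_; con)

open CommutativeRing seriesRing
  using (setoid; +-assoc; +-identityˡ; zeroˡ; distribʳ; *-assoc; *-comm)
  renaming (refl to ≈-refl; sym to ≈-sym; trans to ≈-trans)
module ≈-Reasoning = Relation.Binary.Reasoning.Setoid setoid

⊕-cong : ∀ {f f′ g g′} → f ≈ f′ → g ≈ g′ → f ⊕ g ≈ f′ ⊕ g′
⊕-cong p q = coefficientwise (λ n → cong₂ _+_ (coefficient p n) (coefficient q n))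

⊝-cong : ∀ {f f′ g g′} → f ≈ f′ → g ≈ g′ → f ⊝ g ≈ f′ ⊝ g′
⊝-cong p q = coefficientwise (λ n → cong₂ (λ a b → a + - b) (coefficient p n) (coefficient q n))

⊗-cong : ∀ {f f′ g g′} → f ≈ f′ → g ≈ g′ → f ⊗ g ≈ f′ ⊗ g′
⊗-cong p q = coefficientwise (⊗-cong≗ (coefficient p) (coefficient q))

⊝-congˡ : ∀ {f f′} g → f ≈ f′ → f ⊝ g ≈ f′ ⊝ g
⊝-congˡ g p = ⊝-cong p (≈-refl {g})

⊝-congʳ : ∀ f {g g′} → g ≈ g′ → f ⊝ g ≈ f ⊝ g′
⊝-congʳ f q = ⊝-cong (≈-refl {f}) q

⊗-congˡ : ∀ {f f′} g → f ≈ f′ → f ⊗ g ≈ f′ ⊗ g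
⊗-congˡ g p = ⊗-cong p (≈-refl {g})

⊗-congʳ : ∀ f {g g′} → g ≈ g′ → f ⊗ g ≈ f ⊗ g′
⊗-congʳ f q = ⊗-cong (≈-refl {f}) q

unit-constant : ∀ a → a 0 ≡ 0ℤ → (𝟙 ⊝ a) 0 ≡ 1ℤ
unit-constant a a₀ = cong (λ z → 1ℤ + - z) a₀

-- A series u with constant term 1 is not a zero divisor: if h ⊗ u vanishes,
-- the coefficients of h vanish one after the other.
no-zero-divisor : ∀ u → u 0 ≡ 1ℤ → ∀ h → h ⊗ u ≗ 𝟘 → h ≗ 𝟘
no-zero-divisor u u₀ h hu≈0 zero    = trans (sym (ℤ.*-identityʳ (h 0))) (trans (cong (h 0 *_) (sym u₀)) (hu≈0 0))
no-zero-divisor u u₀ h hu≈0 (suc n) = no-zero-divisor u u₀ (shift h) tail≈0 n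
  where
  h₀≡0 : h 0 ≡ 0ℤ
  h₀≡0 = no-zero-divisor u u₀ h hu≈0 0
  tail≈0 : shift h ⊗ u ≗ 𝟘
  tail≈0 k = begin
    (shift h ⊗ u) k                    ≡⟨ ℤ.+-identityˡ _ ⟨
    0ℤ + (shift h ⊗ u) k               ≡⟨ cong (λ a → a * u (suc k) + (shift h ⊗ u) k) h₀≡0 ⟨
    h 0 * u (suc k) + (shift h ⊗ u) k  ≡⟨ hu≈0 (suc k) ⟩
    0ℤ                                 ∎
    where open ≡-Reasoning

cancelʳ : ∀ {u} → u 0 ≡ 1ℤ → ∀ {f g} → f ⊗ u ≈ g ⊗ u → f ≈ g
cancelʳ {u} u₀ {f} {g} fu≈gu =
  coefficientwise (λ n → ℤ.i-j≡0⇒i≡j (f n) (g n) (no-zero-divisor u u₀ (f ⊝ g) difference n))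
  where
  factor : ∀ u f g → (f ⊝ g) ⊗ u ≈ f ⊗ u ⊝ g ⊗ u
  factor = solve 3 (λ u f g → (f :- g) :* u := f :* u :- g :* u) ≈-refl
  difference : (f ⊝ g) ⊗ u ≗ 𝟘
  difference k = trans (coefficient (factor u f g) k) (ℤ.i≡j⇒i-j≡0 (coefficient fu≈gu k))

-- The quadratic relation satisfied by the generating function G of
-- t-avoiders, t = node t₁ t₂, in terms of those (A, B) of t₁ and t₂.
module TreeEquation (X : Series) where

  Solves : Series → Series → Series → Set
  Solves G A B = G ⊗ (𝟙 ⊝ A ⊝ B) ≈ X ⊝ A ⊗ B

  solves-from-recurrence : ∀ {G A B E} → G ≈ X ⊕ (A ⊗ G ⊕ E ⊗ B) → G ≈ A ⊕ E → Solves G A B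
  solves-from-recurrence {G} {A} {B} {E} rec split = begin
    G ⊗ (𝟙 ⊝ A ⊝ B)                            ≈⟨ expand G A B ⟩
    G ⊝ A ⊗ G ⊝ G ⊗ B                          ≈⟨ ⊝-cong (⊝-congˡ (A ⊗ G) rec) (⊗-congˡ B split) ⟩
    X ⊕ (A ⊗ G ⊕ E ⊗ B) ⊝ A ⊗ G ⊝ (A ⊕ E) ⊗ B  ≈⟨ collect X A B E G ⟩
    X ⊝ A ⊗ B                                  ∎
    where
    open ≈-Reasoning
    expand : ∀ G A B → G ⊗ (𝟙 ⊝ A ⊝ B) ≈ G ⊝ A ⊗ G ⊝ G ⊗ B
    expand = solve 3 (λ G A B → G :* (con 1ℤ :- A :- B) := G :- A :* G :- G :* B) ≈-refl
    collect : ∀ X A B E G → X ⊕ (A ⊗ G ⊕ E ⊗ B) ⊝ A ⊗ G ⊝ (A ⊕ E) ⊗ B ≈ X ⊝ A ⊗ B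
    collect = solve 5 (λ X A B E G → X :+ (A :* G :+ E :* B) :- A :* G :- (A :+ E) :* B := X :- A :* B) ≈-refl

  Solves-cong : ∀ {G A A′ B B′} → A ≈ A′ → B ≈ B′ → Solves G A B → Solves G A′ B′
  Solves-cong {G} {A} {A′} {B} {B′} A≈A′ B≈B′ solves = begin
    G ⊗ (𝟙 ⊝ A′ ⊝ B′)  ≈⟨ ⊗-congʳ G (⊝-cong (⊝-congʳ 𝟙 A≈A′) B≈B′) ⟨
    G ⊗ (𝟙 ⊝ A ⊝ B)    ≈⟨ solves ⟩
    X ⊝ A ⊗ B          ≈⟨ ⊝-congʳ X (⊗-cong A≈A′ B≈B′) ⟩
    X ⊝ A′ ⊗ B′        ∎
    where open ≈-Reasoning

  solves-unique : ∀ {G G′ A B} → A 0 ≡ 0ℤ → B 0 ≡ 0ℤ → Solves G A B → Solves G′ A B → G ≈ G′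
  solves-unique {A = A} {B} A₀ B₀ solves solves′ = cancelʳ unit₀ (≈-trans solves (≈-sym solves′))
    where
    unit₀ : (𝟙 ⊝ A ⊝ B) 0 ≡ 1ℤ
    unit₀ = trans (cong (λ z → (𝟙 ⊝ A) 0 + - z) B₀) (trans (ℤ.+-identityʳ _) (unit-constant A A₀))

  solves-zeroˡ : ∀ {G A B} → A ≈ 𝟘 → Solves G A B → G ⊗ (𝟙 ⊝ B) ≈ X
  solves-zeroˡ {G} {A} {B} A≈0 solves = begin
    G ⊗ (𝟙 ⊝ B)                 ≈⟨ pad G B ⟩
    G ⊗ (𝟙 ⊝ constant 0ℤ ⊝ B)  ≈⟨ ⊗-congʳ G (⊝-congˡ B (⊝-congʳ 𝟙 zero≈A)) ⟩
    G ⊗ (𝟙 ⊝ A ⊝ B)             ≈⟨ solves ⟩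
    X ⊝ A ⊗ B                   ≈⟨ ⊝-congʳ X (⊗-congˡ B (≈-sym zero≈A)) ⟩
    X ⊝ constant 0ℤ ⊗ B         ≈⟨ unpad X B ⟩
    X                           ∎
    where
    open ≈-Reasoning
    zero≈A : constant 0ℤ ≈ A
    zero≈A = ≈-trans constant-0 (≈-sym A≈0)
    pad : ∀ G B → G ⊗ (𝟙 ⊝ B) ≈ G ⊗ (𝟙 ⊝ constant 0ℤ ⊝ B)
    pad = solve 2 (λ G B → G :* (con 1ℤ :- B) := G :* (con 1ℤ :- con 0ℤ :- B)) ≈-refl
    unpad : ∀ X B → X ⊝ constant 0ℤ ⊗ B ≈ X
    unpad = solve 2 (λ X B → X :- con 0ℤ :* B := X) ≈-refl

  -- If a′ (1 - a) = X and b′ (1 - b) = X, then the pairs (a′, b) and (a, b′)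
  -- are interchangeable in the relation (after multiplying by 1 - a resp. 1 - b).
  module _ {a a′ b b′} (a′-rec : a′ ⊗ (𝟙 ⊝ a) ≈ X) (b′-rec : b′ ⊗ (𝟙 ⊝ b) ≈ X) where

    -- both sides equal (1 - a)(1 - b) - X
    exchange-unit : (𝟙 ⊝ a′ ⊝ b) ⊗ (𝟙 ⊝ a) ≈ (𝟙 ⊝ a ⊝ b′) ⊗ (𝟙 ⊝ b)
    exchange-unit = begin
      (𝟙 ⊝ a′ ⊝ b) ⊗ (𝟙 ⊝ a)         ≈⟨ expand a a′ b ⟩
      (𝟙 ⊝ a) ⊗ (𝟙 ⊝ b) ⊝ a′ ⊗ (𝟙 ⊝ a)  ≈⟨ ⊝-congʳ ((𝟙 ⊝ a) ⊗ (𝟙 ⊝ b)) a′-rec ⟩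
      (𝟙 ⊝ a) ⊗ (𝟙 ⊝ b) ⊝ X             ≈⟨ ⊝-congʳ ((𝟙 ⊝ a) ⊗ (𝟙 ⊝ b)) b′-rec ⟨
      (𝟙 ⊝ a) ⊗ (𝟙 ⊝ b) ⊝ b′ ⊗ (𝟙 ⊝ b)  ≈⟨ fold a b b′ ⟩
      (𝟙 ⊝ a ⊝ b′) ⊗ (𝟙 ⊝ b)         ∎
      where
      open ≈-Reasoning
      expand : ∀ a a′ b → (𝟙 ⊝ a′ ⊝ b) ⊗ (𝟙 ⊝ a) ≈ (𝟙 ⊝ a) ⊗ (𝟙 ⊝ b) ⊝ a′ ⊗ (𝟙 ⊝ a)
      expand = solve 3 (λ a a′ b → (con 1ℤ :- a′ :- b) :* (con 1ℤ :- a)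
                                   := (con 1ℤ :- a) :* (con 1ℤ :- b) :- a′ :* (con 1ℤ :- a)) ≈-refl
      fold : ∀ a b b′ → (𝟙 ⊝ a) ⊗ (𝟙 ⊝ b) ⊝ b′ ⊗ (𝟙 ⊝ b) ≈ (𝟙 ⊝ a ⊝ b′) ⊗ (𝟙 ⊝ b)
      fold = solve 3 (λ a b b′ → (con 1ℤ :- a) :* (con 1ℤ :- b) :- b′ :* (con 1ℤ :- b)
                                 := (con 1ℤ :- a :- b′) :* (con 1ℤ :- b)) ≈-refl

    -- both sides equal X (1 - a - b)
    exchange-value : (X ⊝ a′ ⊗ b) ⊗ (𝟙 ⊝ a) ≈ (X ⊝ a ⊗ b′) ⊗ (𝟙 ⊝ b)
    exchange-value = begin
      (X ⊝ a′ ⊗ b) ⊗ (𝟙 ⊝ a)            ≈⟨ expand X a a′ b ⟩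
      X ⊗ (𝟙 ⊝ a) ⊝ a′ ⊗ (𝟙 ⊝ a) ⊗ b     ≈⟨ ⊝-congʳ (X ⊗ (𝟙 ⊝ a)) (⊗-congˡ b a′-rec) ⟩
      X ⊗ (𝟙 ⊝ a) ⊝ X ⊗ b                ≈⟨ swap X a b ⟩
      X ⊗ (𝟙 ⊝ b) ⊝ X ⊗ a                ≈⟨ ⊝-congʳ (X ⊗ (𝟙 ⊝ b)) (⊗-congˡ a b′-rec) ⟨
      X ⊗ (𝟙 ⊝ b) ⊝ b′ ⊗ (𝟙 ⊝ b) ⊗ a     ≈⟨ expand X b b′ a ⟨
      (X ⊝ b′ ⊗ a) ⊗ (𝟙 ⊝ b)            ≈⟨ ⊗-congˡ (𝟙 ⊝ b) (⊝-congʳ X (*-comm b′ a)) ⟩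
      (X ⊝ a ⊗ b′) ⊗ (𝟙 ⊝ b)            ∎
      where
      open ≈-Reasoning
      expand : ∀ X a a′ b → (X ⊝ a′ ⊗ b) ⊗ (𝟙 ⊝ a) ≈ X ⊗ (𝟙 ⊝ a) ⊝ a′ ⊗ (𝟙 ⊝ a) ⊗ b
      expand = solve 4 (λ X a a′ b → (X :- a′ :* b) :* (con 1ℤ :- a)
                                     := X :* (con 1ℤ :- a) :- a′ :* (con 1ℤ :- a) :* b) ≈-refl
      swap : ∀ X a b → X ⊗ (𝟙 ⊝ a) ⊝ X ⊗ b ≈ X ⊗ (𝟙 ⊝ b) ⊝ X ⊗ a
      swap = solve 3 (λ X a b → X :* (con 1ℤ :- a) :- X :* b := X :* (con 1ℤ :- b) :- X :* a) ≈-refl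

    -- multiply the hypothesis by 1 - b, rewrite with the two identities, cancel 1 - a
    exchange : a 0 ≡ 0ℤ → ∀ {D} → Solves D a b′ → Solves D a′ b
    exchange a₀ {D} solves = cancelʳ (unit-constant a a₀) (begin
      D ⊗ (𝟙 ⊝ a′ ⊝ b) ⊗ (𝟙 ⊝ a)    ≈⟨ *-assoc D (𝟙 ⊝ a′ ⊝ b) (𝟙 ⊝ a) ⟩
      D ⊗ ((𝟙 ⊝ a′ ⊝ b) ⊗ (𝟙 ⊝ a))  ≈⟨ ⊗-congʳ D exchange-unit ⟩
      D ⊗ ((𝟙 ⊝ a ⊝ b′) ⊗ (𝟙 ⊝ b))  ≈⟨ *-assoc D (𝟙 ⊝ a ⊝ b′) (𝟙 ⊝ b) ⟨
      D ⊗ (𝟙 ⊝ a ⊝ b′) ⊗ (𝟙 ⊝ b)    ≈⟨ ⊗-congˡ (𝟙 ⊝ b) solves ⟩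
      (X ⊝ a ⊗ b′) ⊗ (𝟙 ⊝ b)        ≈⟨ exchange-value ⟨
      (X ⊝ a′ ⊗ b) ⊗ (𝟙 ⊝ a)        ∎)
      where open ≈-Reasoning

  -- A sequence c behaving like the generating functions of combs: c₀ = 0,
  -- no constant terms, and c_{m+1} solves the relation with (c₀, c_m).
  module CombSequence (c : ℕ → Series) (c-zero : c 0 ≈ 𝟘) (c-constant : ∀ m → c m 0 ≡ 0ℤ)
                      (c-solves : ∀ m → Solves (c (suc m)) (c 0) (c m)) where

    c-recurrence : ∀ m → c (suc m) ⊗ (𝟙 ⊝ c m) ≈ X
    c-recurrence m = solves-zeroˡ c-zero (c-solves m)

    -- by induction on x: the case (x + 1, y) follows from (x, y + 1) by exchange
    comb-addition : ∀ x y → Solves (c (suc (x ℕ.+ y))) (c x) (c y)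
    comb-addition zero    y = c-solves y
    comb-addition (suc x) y = exchange (c-recurrence x) (c-recurrence y) (c-constant x) shifted
      where
      shifted : Solves (c (suc (suc x ℕ.+ y))) (c x) (c (suc y))
      shifted = subst (λ k → Solves (c (suc k)) (c x) (c (suc y))) (ℕ.+-suc x y) (comb-addition x (suc y))

𝕀 : Bool → ℤ
𝕀 true  = 1ℤ
𝕀 false = 0ℤ

monomial : ℕ → Series
monomial a n = 𝕀 (a ≡ᵇ n)

X : Series
X = monomial 1

open TreeEquation X

∑ : {A : Set} → List A → (A → Series) → Series
∑ []       F = 𝟘
∑ (a ∷ as) F = F a ⊕ ∑ as F

syntax ∑ xs (λ a → F) = ∑[ a ∈ xs ] F

module _ {A : Set} where

  ∑-cong-at : ∀ (xs : List A) n {F G} → (∀ a → F a n ≡ G a n) → ∑ xs F n ≡ ∑ xs G n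
  ∑-cong-at []       n F≡G = refl
  ∑-cong-at (a ∷ as) n F≡G = cong₂ _+_ (F≡G a) (∑-cong-at as n F≡G)

  ∑-cong : ∀ (xs : List A) {F G} → (∀ a → F a ≈ G a) → ∑ xs F ≈ ∑ xs G
  ∑-cong xs F≈G = coefficientwise (λ n → ∑-cong-at xs n (λ a → coefficient (F≈G a) n))

  ∑-++ : ∀ (xs ys : List A) F → ∑ (xs ++ ys) F ≈ ∑ xs F ⊕ ∑ ys F
  ∑-++ []       ys F = ≈-sym (+-identityˡ (∑ ys F))
  ∑-++ (a ∷ as) ys F = ≈-trans (⊕-cong (≈-refl {F a}) (∑-++ as ys F)) (≈-sym (+-assoc (F a) (∑ as F) (∑ ys F)))

  ∑-⊕ : ∀ (xs : List A) F G → ∑[ a ∈ xs ] (F a ⊕ G a) ≈ ∑ xs F ⊕ ∑ xs G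
  ∑-⊕ []       F G = ≈-sym (+-identityˡ 𝟘)
  ∑-⊕ (a ∷ as) F G = ≈-trans (⊕-cong (≈-refl {F a ⊕ G a}) (∑-⊕ as F G)) (interchange (F a) (G a) (∑ as F) (∑ as G))
    where
    interchange : ∀ p q r s → (p ⊕ q) ⊕ (r ⊕ s) ≈ (p ⊕ r) ⊕ (q ⊕ s)
    interchange = solve 4 (λ p q r s → (p :+ q) :+ (r :+ s) := (p :+ r) :+ (q :+ s)) ≈-refl

  ∑-⊗ˡ : ∀ (xs : List A) F g → ∑ xs F ⊗ g ≈ ∑[ a ∈ xs ] (F a ⊗ g)
  ∑-⊗ˡ []       F g = zeroˡ g
  ∑-⊗ˡ (a ∷ as) F g = ≈-trans (distribʳ g (F a) (∑ as F)) (⊕-cong (≈-refl {F a ⊗ g}) (∑-⊗ˡ as F g))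

  ∑-vanishes : ∀ (xs : List A) F n → (∀ a → F a n ≡ 0ℤ) → ∑ xs F n ≡ 0ℤ
  ∑-vanishes []       F n F≡0 = refl
  ∑-vanishes (a ∷ as) F n F≡0 = cong₂ _+_ (F≡0 a) (∑-vanishes as F n F≡0)

  count-filter : ∀ {P : A → Set} (P? : ∀ a → Dec (P a)) (xs : List A) F n →
                 (∀ a → F a n ≡ 𝕀 (does (P? a))) → ℤ.+ length (filter P? xs) ≡ ∑ xs F n
  count-filter P? []       F n F≡𝕀 = refl
  count-filter P? (a ∷ as) F n F≡𝕀 with does (P? a) | F≡𝕀 a
  ... | true  | Fa≡1 = trans (ℤ.pos-+ 1 (length (filter P? as)))
                              (cong₂ _+_ (sym Fa≡1) (count-filter P? as F n F≡𝕀))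
  ... | false | Fa≡0 = trans (sym (ℤ.+-identityˡ _)) (cong₂ _+_ (sym Fa≡0) (count-filter P? as F n F≡𝕀))

∑-product : ∀ {A B : Set} (xs : List A) (ys : List B) F G →
            ∑ xs F ⊗ ∑ ys G ≈ ∑[ a ∈ xs ] ∑[ b ∈ ys ] (F a ⊗ G b)
∑-product xs ys F G = ≈-trans (∑-⊗ˡ xs F (∑ ys G)) (∑-cong xs (λ a → ≈-trans (*-comm (F a) (∑ ys G))
  (≈-trans (∑-⊗ˡ ys G (F a)) (∑-cong ys (λ b → *-comm (G b) (F a))))))

∑-concatMap : ∀ {A B : Set} (g : A → List B) xs F → ∑ (concatMap g xs) F ≈ ∑[ a ∈ xs ] ∑ (g a) F
∑-concatMap g []       F = ≈-refl
∑-concatMap g (a ∷ as) F =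
  ≈-trans (∑-++ (g a) (concatMap g as) F) (⊕-cong (≈-refl {∑ (g a) F}) (∑-concatMap g as F))

∑-map : ∀ {A B : Set} (f : A → B) xs F → ∑ (map f xs) F ≈ ∑[ a ∈ xs ] F (f a)
∑-map f []       F = ≈-refl
∑-map f (a ∷ as) F = ⊕-cong (≈-refl {F (f a)}) (∑-map f as F)

⊗-cong-upto : ∀ n {f f′ g g′} → (∀ i → i ≤ n → f i ≡ f′ i) → (∀ i → i ≤ n → g i ≡ g′ i) →
              (f ⊗ g) n ≡ (f′ ⊗ g′) n
⊗-cong-upto zero    f≡ g≡ = cong₂ _*_ (f≡ 0 z≤n) (g≡ 0 z≤n)
⊗-cong-upto (suc n) f≡ g≡ = cong₂ _+_ (cong₂ _*_ (f≡ 0 z≤n) (g≡ (suc n) ℕ.≤-refl))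
  (⊗-cong-upto n (λ i i≤n → f≡ (suc i) (s≤s i≤n)) (λ i i≤n → g≡ i (ℕ.m≤n⇒m≤1+n i≤n)))

monomial-below : ∀ {a n} → n < a → monomial a n ≡ 0ℤ
monomial-below {suc a} {zero}  _           = refl
monomial-below {suc a} {suc n} (s≤s n<a) = monomial-below {a} {n} n<a

monomial-⊗ : ∀ a b → monomial a ⊗ monomial b ≗ monomial (a ℕ.+ b)
monomial-⊗ zero    zero    zero    = refl
monomial-⊗ zero    (suc b) zero    = refl
monomial-⊗ (suc a) b       zero    = refl
monomial-⊗ zero    b       (suc n) = begin
    1ℤ * monomial b (suc n) + (𝟘 ⊗ monomial b) n
  ≡⟨ cong₂ _+_ (ℤ.*-identityˡ (monomial b (suc n))) (⊗-zeroˡ (monomial b) n) ⟩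
    monomial b (suc n) + 0ℤ
  ≡⟨ ℤ.+-identityʳ _ ⟩
    monomial b (suc n) ∎
  where open ≡-Reasoning
monomial-⊗ (suc a) b       (suc n) = trans (ℤ.+-identityˡ _) (monomial-⊗ a b n)

weighted-monomial-⊗ : ∀ u v a b → (u • monomial a) ⊗ (v • monomial b) ≈ (u * v) • monomial (a ℕ.+ b)
weighted-monomial-⊗ u v a b = coefficientwise λ n → begin
  ((u • monomial a) ⊗ (v • monomial b)) n  ≡⟨ ⊗-scaleˡ u (monomial a) (v • monomial b) n ⟩
  u * (monomial a ⊗ (v • monomial b)) n    ≡⟨ cong (u *_) (⊗-comm (monomial a) (v • monomial b) n) ⟩
  u * ((v • monomial b) ⊗ monomial a) n    ≡⟨ cong (u *_) (⊗-scaleˡ v (monomial b) (monomial a) n) ⟩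
  u * (v * (monomial b ⊗ monomial a) n)    ≡⟨ ℤ.*-assoc u v _ ⟨
  u * v * (monomial b ⊗ monomial a) n      ≡⟨ cong (u * v *_) (⊗-comm (monomial b) (monomial a) n) ⟩
  u * v * (monomial a ⊗ monomial b) n      ≡⟨ cong (u * v *_) (monomial-⊗ a b n) ⟩
  u * v * monomial (a ℕ.+ b) n             ∎
  where open ≡-Reasoning

•-identityˡ : ∀ f → 1ℤ • f ≈ f
•-identityˡ f = coefficientwise (λ n → ℤ.*-identityˡ (f n))

•-distribʳ : ∀ u v f → (u + v) • f ≈ u • f ⊕ v • f
•-distribʳ u v f = coefficientwise (λ n → ℤ.*-distribʳ-+ (f n) u v)

leaves-positive : ∀ T → 1 ≤ leaves T
leaves-positive leaf       = s≤s z≤n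
leaves-positive (node l r) = ℕ.≤-trans (leaves-positive l) (ℕ.m≤m+n (leaves l) (leaves r))

H : ℕ → List Tree
H = treesOfHeight≤

∑-trees-suc : ∀ d F → ∑ (H (suc d)) F ≈ F leaf ⊕ ∑[ l ∈ H d ] ∑[ r ∈ H d ] F (node l r)
∑-trees-suc d F = ⊕-cong (≈-refl {F leaf})
  (≈-trans (∑-concatMap (λ l → map (node l) (H d)) (H d) F) (∑-cong (H d) (λ l → ∑-map (node l) (H d) F)))

-- A tree of height d + 1 has more than d + 1 leaves, so enlarging the height
-- bound does not change a sum whose summands vanish on trees with more than
-- d leaves.
∑-trees-stable : ∀ d F n → (∀ T → d < leaves T → F T n ≡ 0ℤ) → ∑ (H d) F n ≡ ∑ (H (suc d)) F n
∑-trees-stable zero    F n F≡0 =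
  trans (∑-vanishes (H 0) F n all-vanish) (sym (∑-vanishes (H 1) F n all-vanish))
  where
  all-vanish : ∀ T → F T n ≡ 0ℤ
  all-vanish T = F≡0 T (leaves-positive T)
∑-trees-stable (suc d) F n F≡0 = begin
    ∑ (H (suc d)) F n
  ≡⟨ coefficient (∑-trees-suc d F) n ⟩
    F leaf n + (∑[ l ∈ H d ] ∑[ r ∈ H d ] F (node l r)) n
  ≡⟨ cong (F leaf n +_) (trans right-subtrees left-subtrees) ⟩
    F leaf n + (∑[ l ∈ H (suc d) ] ∑[ r ∈ H (suc d) ] F (node l r)) n
  ≡⟨ coefficient (∑-trees-suc (suc d) F) n ⟨
    ∑ (H (suc (suc d))) F n ∎
  where
  open ≡-Reasoning
  more-leavesʳ : ∀ l r → d < leaves r → suc d < leaves (node l r)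
  more-leavesʳ l r d<r = ℕ.+-mono-≤ (leaves-positive l) d<r
  more-leavesˡ : ∀ l r → d < leaves l → suc d < leaves (node l r)
  more-leavesˡ l r d<l = subst (suc (suc d) ≤_) (ℕ.+-comm (leaves r) (leaves l)) (ℕ.+-mono-≤ (leaves-positive r) d<l)
  right-subtrees : (∑[ l ∈ H d ] ∑[ r ∈ H d ] F (node l r)) n
                 ≡ (∑[ l ∈ H d ] ∑[ r ∈ H (suc d) ] F (node l r)) n
  right-subtrees = ∑-cong-at (H d) n (λ l →
    ∑-trees-stable d (λ r → F (node l r)) n (λ r d<r → F≡0 (node l r) (more-leavesʳ l r d<r)))
  left-subtrees : (∑[ l ∈ H d ] ∑[ r ∈ H (suc d) ] F (node l r)) n
                ≡ (∑[ l ∈ H (suc d) ] ∑[ r ∈ H (suc d) ] F (node l r)) n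
  left-subtrees = ∑-trees-stable d (λ l → ∑[ r ∈ H (suc d) ] F (node l r)) n (λ l d<l →
    ∑-vanishes (H (suc d)) (λ r → F (node l r)) n (λ r → F≡0 (node l r) (more-leavesˡ l r d<l)))

∑-trees-stable* : ∀ {d e} → d ≤′ e → ∀ F n → (∀ T → d < leaves T → F T n ≡ 0ℤ) → ∑ (H d) F n ≡ ∑ (H e) F n
∑-trees-stable* ℕ.≤′-refl          F n F≡0 = refl
∑-trees-stable* (ℕ.≤′-step {e} d≤e) F n F≡0 = trans (∑-trees-stable* d≤e F n F≡0)
  (∑-trees-stable e F n (λ T e<T → F≡0 T (ℕ.≤-<-trans (ℕ.≤′⇒≤ d≤e) e<T)))

heightPolynomial : ℕ → (Tree → ℤ) → Series
heightPolynomial d w = ∑[ T ∈ H d ] (w T • monomial (leaves T))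

-- The generating function ∑ w(T) x^{leaves T} over all trees: its n-th
-- coefficient involves trees with n leaves only, which have height ≤ n.
gf : (Tree → ℤ) → Series
gf w n = heightPolynomial n w n

heightPolynomial-stable : ∀ w {n d} → n ≤ d → heightPolynomial d w n ≡ gf w n
heightPolynomial-stable w {n} n≤d = sym (∑-trees-stable* (ℕ.≤⇒≤′ n≤d) _ n
  (λ T n<T → trans (cong (w T *_) (monomial-below n<T)) (ℤ.*-zeroʳ (w T))))

heightPolynomial-⊗ : ∀ d u v → heightPolynomial d u ⊗ heightPolynomial d v ≈
                     ∑[ l ∈ H d ] ∑[ r ∈ H d ] ((u l * v r) • monomial (leaves (node l r)))
heightPolynomial-⊗ d u v = ≈-trans (∑-product (H d) (H d) _ _) (∑-cong (H d) (λ l → ∑-cong (H d) (λ r →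
  weighted-monomial-⊗ (u l) (v r) (leaves l) (leaves r))))

heightPolynomial-root : ∀ d W u₁ v₁ u₂ v₂ → (∀ l r → W (node l r) ≡ u₁ l * v₁ r + u₂ l * v₂ r) →
  heightPolynomial (suc d) W ≈
  W leaf • X ⊕ (heightPolynomial d u₁ ⊗ heightPolynomial d v₁ ⊕ heightPolynomial d u₂ ⊗ heightPolynomial d v₂)
heightPolynomial-root d W u₁ v₁ u₂ v₂ W-node = begin
    P (suc d) W
  ≈⟨ ∑-trees-suc d (λ T → W T • monomial (leaves T)) ⟩
    W leaf • X ⊕ ∑[ l ∈ H d ] ∑[ r ∈ H d ] (W (node l r) • m l r)
  ≈⟨ ⊕-cong (≈-refl {W leaf • X}) (∑-cong (H d) (λ l → ∑-cong (H d) (λ r → split l r))) ⟩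
    W leaf • X ⊕ ∑[ l ∈ H d ] ∑[ r ∈ H d ] ((u₁ l * v₁ r) • m l r ⊕ (u₂ l * v₂ r) • m l r)
  ≈⟨ ⊕-cong (≈-refl {W leaf • X}) (≈-trans (∑-cong (H d) (λ l → ∑-⊕ (H d) _ _)) (∑-⊕ (H d) _ _)) ⟩
    W leaf • X ⊕ (∑[ l ∈ H d ] ∑[ r ∈ H d ] ((u₁ l * v₁ r) • m l r)
                  ⊕ ∑[ l ∈ H d ] ∑[ r ∈ H d ] ((u₂ l * v₂ r) • m l r))
  ≈⟨ ⊕-cong (≈-refl {W leaf • X}) (⊕-cong (heightPolynomial-⊗ d u₁ v₁) (heightPolynomial-⊗ d u₂ v₂)) ⟨
    W leaf • X ⊕ (P d u₁ ⊗ P d v₁ ⊕ P d u₂ ⊗ P d v₂) ∎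
  where
  open ≈-Reasoning
  P : ℕ → (Tree → ℤ) → Series
  P = heightPolynomial
  m : Tree → Tree → Series
  m l r = monomial (leaves (node l r))
  split : ∀ l r → W (node l r) • m l r ≈ (u₁ l * v₁ r) • m l r ⊕ (u₂ l * v₂ r) • m l r
  split l r = ≈-trans (coefficientwise (λ n → cong (_* m l r n) (W-node l r)))
                      (•-distribʳ (u₁ l * v₁ r) (u₂ l * v₂ r) (m l r))

heightPolynomial-⊗-stable : ∀ n u v → (heightPolynomial n u ⊗ heightPolynomial n v) n ≡ (gf u ⊗ gf v) n
heightPolynomial-⊗-stable n u v = ⊗-cong-upto n (λ i → heightPolynomial-stable u) (λ i → heightPolynomial-stable v)

gf-root : ∀ W u₁ v₁ u₂ v₂ → (∀ l r → W (node l r) ≡ u₁ l * v₁ r + u₂ l * v₂ r) →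
          gf W ≈ W leaf • X ⊕ (gf u₁ ⊗ gf v₁ ⊕ gf u₂ ⊗ gf v₂)
gf-root W u₁ v₁ u₂ v₂ W-node = coefficientwise at
  where
  open ≡-Reasoning
  P : ℕ → (Tree → ℤ) → Series
  P = heightPolynomial
  at : ∀ n → gf W n ≡ (W leaf • X ⊕ (gf u₁ ⊗ gf v₁ ⊕ gf u₂ ⊗ gf v₂)) n
  at n = begin
      gf W n
    ≡⟨ heightPolynomial-stable W (ℕ.n≤1+n n) ⟨
      heightPolynomial (suc n) W n
    ≡⟨ coefficient (heightPolynomial-root n W u₁ v₁ u₂ v₂ W-node) n ⟩
      (W leaf • X) n + ((P n u₁ ⊗ P n v₁) n + (P n u₂ ⊗ P n v₂) n)
    ≡⟨ cong ((W leaf • X) n +_) (cong₂ _+_ (heightPolynomial-⊗-stable n u₁ v₁) (heightPolynomial-⊗-stable n u₂ v₂)) ⟩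
      (W leaf • X) n + ((gf u₁ ⊗ gf v₁) n + (gf u₂ ⊗ gf v₂) n) ∎

gf-cong : ∀ {w w′} → (∀ T → w T ≡ w′ T) → gf w ≈ gf w′
gf-cong w≡w′ = coefficientwise (λ n → ∑-cong-at (H n) n (λ T → cong (λ c → c * monomial (leaves T) n) (w≡w′ T)))

gf-+ : ∀ w w′ → gf (λ T → w T + w′ T) ≈ gf w ⊕ gf w′
gf-+ w w′ = coefficientwise (λ n → coefficient
  (≈-trans (∑-cong (H n) (λ T → •-distribʳ (w T) (w′ T) (monomial (leaves T)))) (∑-⊕ (H n) _ _)) n)

-- No tree has zero leaves.
gf-constant : ∀ w → gf w 0 ≡ 0ℤ
gf-constant w = trans (ℤ.+-identityʳ _) (ℤ.*-zeroʳ (w leaf))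

⊇-refl : ∀ T → Contains T T
⊇-refl leaf       = here-leaf
⊇-refl (node l r) = here-node (⊇-refl l) (⊇-refl r)

⊇-trans : ∀ {T u v} → Contains T u → Contains u v → Contains T v
⊇-trans _               here-leaf       = here-leaf
⊇-trans (here-node P Q) (here-node p q) = here-node (⊇-trans P p) (⊇-trans Q q)
⊇-trans (here-node P Q) (go-left p)     = go-left (⊇-trans P p)
⊇-trans (here-node P Q) (go-right q)    = go-right (⊇-trans Q q)
⊇-trans (go-left P)     u⊇v             = go-left (⊇-trans P u⊇v)
⊇-trans (go-right P)    u⊇v             = go-right (⊇-trans P u⊇v)

contains : Tree → Tree → Bool
contains T t = does (contains? T t)

contains-sub : ∀ {t s} → Contains t s → ∀ T → Holds (contains T t) → Holds (contains T s)
contains-sub {t} {s} t⊇s T holds with contains? T t | contains? T s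
... | yes _   | yes _   = tt
... | yes T⊇t | no  T⊉s = ⊥-elim (T⊉s (⊇-trans T⊇t t⊇s))
... | no  _   | _       = ⊥-elim holds

avoids : Tree → Tree → ℤ
avoids t T = 𝕀 (not (contains T t))

-- Reading p, P as
-- "l contains t₁", "l contains t" (and q, Q likewise for r and t₂, t):
-- T avoids t  iff  T avoids t₁, or T contains t₁ but avoids t.
avoid-split-table : ∀ p P → (Holds P → Holds p) → 𝕀 (not P) ≡ 𝕀 (not p) + 𝕀 (not P) * 𝕀 p
avoid-split-table true  true  _   = refl
avoid-split-table true  false _   = refl
avoid-split-table false true  P⇒p = ⊥-elim (P⇒p tt)
avoid-split-table false false _   = refl

-- node l r avoids t = node t₁ t₂  iff  l avoids t₁ and r avoids t, or
-- l contains t₁ but avoids t, and r avoids t₂.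
avoid-node-table : ∀ p q P Q → (Holds P → Holds p) → (Holds Q → Holds q) →
  𝕀 (not ((p ∧ q) ∨ (P ∨ Q))) ≡ 𝕀 (not p) * 𝕀 (not Q) + (𝕀 (not P) * 𝕀 p) * 𝕀 (not q)
avoid-node-table true  true  true  true  _   _   = refl
avoid-node-table true  true  true  false _   _   = refl
avoid-node-table true  true  false true  _   _   = refl
avoid-node-table true  true  false false _   _   = refl
avoid-node-table true  false P     true  _   Q⇒q = ⊥-elim (Q⇒q tt)
avoid-node-table true  false true  false _   _   = refl
avoid-node-table true  false false false _   _   = refl
avoid-node-table false q     true  Q     P⇒p _   = ⊥-elim (P⇒p tt)
avoid-node-table false true  false true  _   _   = refl
avoid-node-table false true  false false _   _   = refl
avoid-node-table false false false true  _   Q⇒q = ⊥-elim (Q⇒q tt)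
avoid-node-table false false false false _   _   = refl

avoiders : Tree → Series
avoiders t = gf (avoids t)

-- every tree contains the one-leaf pattern
avoiders-leaf : avoiders leaf ≈ 𝟘
avoiders-leaf = coefficientwise (λ n → ∑-vanishes (H n) _ n (λ T → ℤ.*-zeroˡ (monomial (leaves T) n)))

module Decomposition (t₁ t₂ : Tree) where

  t : Tree
  t = node t₁ t₂

  between : Tree → ℤ
  between T = avoids t T * 𝕀 (contains T t₁)

  avoiders-split : avoiders t ≈ avoiders t₁ ⊕ gf between
  avoiders-split = ≈-trans (gf-cong (λ T → avoid-split-table (contains T t₁) (contains T t) (contains-sub t⊇t₁ T)))
                    (gf-+ (avoids t₁) between)
    where
    t⊇t₁ : Contains t t₁
    t⊇t₁ = go-left (⊇-refl t₁)

  -- g_t = x + g_{t₁} g_t + (g_t - g_{t₁}) g_{t₂}, splitting node l r according to l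
  avoiders-node : avoiders t ≈ X ⊕ (avoiders t₁ ⊗ avoiders t ⊕ gf between ⊗ avoiders t₂)
  avoiders-node = ≈-trans (gf-root (avoids t) (avoids t₁) (avoids t) between (avoids t₂) node-weight)
                   (⊕-cong (•-identityˡ X) (≈-refl {avoiders t₁ ⊗ avoiders t ⊕ gf between ⊗ avoiders t₂}))
    where
    node-weight : ∀ l r → avoids t (node l r) ≡ avoids t₁ l * avoids t r + between l * avoids t₂ r
    node-weight l r = avoid-node-table (contains l t₁) (contains r t₂) (contains l t) (contains r t)
                        (contains-sub (go-left (⊇-refl t₁)) l) (contains-sub (go-right (⊇-refl t₂)) r)

  avoiders-solves : Solves (avoiders t) (avoiders t₁) (avoiders t₂)
  avoiders-solves = solves-from-recurrence avoiders-node avoiders-split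

-- right combs; comb k has k + 1 leaves
comb : ℕ → Tree
comb zero    = leaf
comb (suc k) = node leaf (comb k)

internal : Tree → ℕ
internal leaf       = 0
internal (node l r) = suc (internal l ℕ.+ internal r)

leaves≡1+internal : ∀ T → leaves T ≡ suc (internal T)
leaves≡1+internal leaf       = refl
leaves≡1+internal (node l r) = trans (cong₂ ℕ._+_ (leaves≡1+internal l) (leaves≡1+internal r))
                                     (cong suc (ℕ.+-suc (internal l) (internal r)))

open CombSequence (λ k → avoiders (comb k)) avoiders-leaf (λ m → gf-constant (avoids (comb m)))
                  (λ m → Decomposition.avoiders-solves leaf (comb m))

avoiders≈comb : ∀ t → avoiders t ≈ avoiders (comb (internal t))
avoiders≈comb leaf         = ≈-refl
avoiders≈comb (node t₁ t₂) = solves-unique (gf-constant (avoids (comb x))) (gf-constant (avoids (comb y)))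
  (Solves-cong (avoiders≈comb t₁) (avoiders≈comb t₂) (Decomposition.avoiders-solves t₁ t₂)) (comb-addition x y)
  where
  x y : ℕ
  x = internal t₁
  y = internal t₂

av≡avoiders : ∀ t n → ℤ.+ av t n ≡ avoiders t n
av≡avoiders t n = count-filter _ (H n) (λ T → avoids t T • monomial (leaves T)) n
             (λ T → 𝕀-∧ (leaves T ≡ᵇ n) (not (contains T t)))
  where
  𝕀-∧ : ∀ a b → 𝕀 b * 𝕀 a ≡ 𝕀 (a ∧ b)
  𝕀-∧ true  b = ℤ.*-identityʳ (𝕀 b)
  𝕀-∧ false b = ℤ.*-zeroʳ (𝕀 b)

lemma4 : (k : ℕ) → (t s : Tree) → leaves t ≡ suc k → leaves s ≡ suc k →
         (n : ℕ) → av t n ≡ av s n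
lemma4 k t s t-leaves s-leaves n = ℤ.+-injective (begin
    ℤ.+ av t n                      ≡⟨ av≡avoiders t n ⟩
    avoiders t n                    ≡⟨ coefficient (avoiders≈comb t) n ⟩
    avoiders (comb (internal t)) n  ≡⟨ cong (λ m → avoiders (comb m) n) same-size ⟩
    avoiders (comb (internal s)) n  ≡⟨ coefficient (avoiders≈comb s) n ⟨
    avoiders s n                    ≡⟨ av≡avoiders s n ⟨
    ℤ.+ av s n                      ∎)
  where
  open ≡-Reasoning
  internal≡ : ∀ T → leaves T ≡ suc k → internal T ≡ k
  internal≡ T T-leaves = ℕ.suc-injective (trans (sym (leaves≡1+internal T)) T-leaves)
  same-size : internal t ≡ internal s
  same-size = trans (internal≡ t t-leaves) (sym (internal≡ s s-leaves))
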